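{- Let $m\geq 1$ and $n\geq 2$, let $T_n$ be a tree with $n$ vertices, and let $\overline{K_m}$ be the edgeless graph on $m$ vertices. Then $m+1\leq \chi_L(T_n\odot \overline{K_m})\leq \chi_L(T_n)+m$.
   Context: All graphs are finite and simple. For a connected graph $G$, a $k$-coloring is a map $c:V(G)\to\{1,\ldots,k\}$ with $c(u)\neq c(v)$ whenever $uv\in E(G)$; it induces the partition $\Pi=\{C_1,\ldots,C_k\}$ into color classes. The color code of $v$ is $c_\Pi(v)=(d(v,C_1),\ldots,d(v,C_k))$, where $d(v,C_i)=\min\{d(v,x): x\in C_i\}$. The coloring is locating if distinct vertices have distinct color codes; $\chi_L(G)$ is the least $k$ admitting a locating $k$-coloring. The corona product $G\odot H$ (for $V(G)=\{a_1,\ldots,a_n\}$) is obtained from one copy of $G$ and $n$ copies of $H$ by joining $a_i$ to every vertex of the $i$-th copy of $H$. -}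

module Defs where

open import Data.Nat using (ℕ; zero; suc; _≤_)
open import Data.Fin using (Fin; zero; suc; fromℕ; inject₁)
open import Data.Bool using (Bool; true; false)
open import Data.Sum using (_⊎_; inj₁; inj₂)
open import Data.Product using (Σ; ∃; _×_; _,_)
open import Data.Empty using (⊥)
open import Relation.Nullary using (¬_)
open import Relation.Binary.PropositionalEquality using (_≡_; _≢_; refl)
open import Function using (Injective; Surjective)
open import Data.Bool using (_∧_)
open import Data.Bool.Properties using (∧-zeroʳ)
import Data.Fin as F
open import Relation.Nullary using (yes; no)
open import Relation.Nullary.Decidable using (⌊_⌋)
open import Data.Empty using (⊥-elim)
import Relation.Binary.PropositionalEquality as P

record Graph (V : Set) : Set where
  field
    adj   : V → V → Bool
    sym   : ∀ u v → adj u v ≡ adj v u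
    irref : ∀ v → adj v v ≡ false
open Graph public

data Walk {V : Set} (G : Graph V) : V → V → ℕ → Set where
  here : ∀ {u} → Walk G u u 0
  step : ∀ {u w v k} → adj G u w ≡ true → Walk G w v k → Walk G u v (suc k)

Dist : {V : Set} → Graph V → V → V → ℕ → Set
Dist G u v k = Walk G u v k × (∀ j → Walk G u v j → k ≤ j)

Connected : {V : Set} → Graph V → Set
Connected G = ∀ u v → ∃ λ k → Walk G u v k

-- A cycle: distinct vertices f 0, …, f (k+2) (k+3 ≥ 3 of them),
-- consecutive ones adjacent, and the last adjacent to the first.
HasCycle : {n : ℕ} → Graph (Fin n) → Set
HasCycle {n} G =
  Σ ℕ λ k → Σ (Fin (suc (suc (suc k))) → Fin n) λ f →
    Injective _≡_ _≡_ f
    × (∀ (i : Fin (suc (suc k))) → adj G (f (inject₁ i)) (f (suc i)) ≡ true)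
    × adj G (f (fromℕ (suc (suc k)))) (f zero) ≡ true

IsTree : {n : ℕ} → Graph (Fin n) → Set
IsTree G = Connected G × ¬ HasCycle G

Empty : (m : ℕ) → Graph (Fin m)
Empty m = record { adj = λ _ _ → false ; sym = λ _ _ → refl ; irref = λ _ → refl }

-- Corona product G ⊙ H for G on Fin n: vertex inj₁ a is vertex a of G;
-- vertex inj₂ (a , w) is vertex w of the a-th copy of H.
CVert : ℕ → Set → Set
CVert n W = Fin n ⊎ (Fin n × W)

coronaAdj : {n : ℕ} {W : Set} → Graph (Fin n) → Graph W → CVert n W → CVert n W → Bool
coronaAdj G H (inj₁ a) (inj₁ b) = adj G a b
coronaAdj G H (inj₁ a) (inj₂ (b , w)) = ⌊ a F.≟ b ⌋
coronaAdj G H (inj₂ (a , w)) (inj₁ b) = ⌊ a F.≟ b ⌋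
coronaAdj G H (inj₂ (a , w)) (inj₂ (b , w')) = ⌊ a F.≟ b ⌋ ∧ adj H w w'

private
  ≟-sym : {n : ℕ} (a b : Fin n) → ⌊ a F.≟ b ⌋ ≡ ⌊ b F.≟ a ⌋
  ≟-sym a b with a F.≟ b | b F.≟ a
  ... | yes _ | yes _ = refl
  ... | no _ | no _ = refl
  ... | yes p | no q = ⊥-elim (q (P.sym p))
  ... | no p | yes q = ⊥-elim (p (P.sym q))

  coronaSym : {n : ℕ} {W : Set} (G : Graph (Fin n)) (H : Graph W) →
              ∀ u v → coronaAdj G H u v ≡ coronaAdj G H v u
  coronaSym G H (inj₁ a) (inj₁ b) = sym G a b
  coronaSym G H (inj₁ a) (inj₂ (b , w)) = ≟-sym a b
  coronaSym G H (inj₂ (a , w)) (inj₁ b) = ≟-sym a b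
  coronaSym G H (inj₂ (a , w)) (inj₂ (b , w')) = P.cong₂ _∧_ (≟-sym a b) (sym H w w')

  coronaIrr : {n : ℕ} {W : Set} (G : Graph (Fin n)) (H : Graph W) →
              ∀ v → coronaAdj G H v v ≡ false
  coronaIrr G H (inj₁ a) = irref G a
  coronaIrr G H (inj₂ (a , w)) rewrite irref H w = ∧-zeroʳ ⌊ a F.≟ a ⌋

corona : {n : ℕ} {W : Set} → Graph (Fin n) → Graph W → Graph (CVert n W)
corona G H = record { adj = coronaAdj G H ; sym = coronaSym G H ; irref = coronaIrr G H }

-- A (proper) k-coloring whose color classes C_1..C_k form a partition (all nonempty).
IsColoring : {V : Set} → Graph V → (k : ℕ) → (V → Fin k) → Set
IsColoring G k c = (∀ u v → adj G u v ≡ true → c u ≢ c v) × Surjective _≡_ _≡_ c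

DistClass : {V : Set} → Graph V → {k : ℕ} → (V → Fin k) → V → Fin k → ℕ → Set
DistClass G c v i d =
  (∃ λ x → c x ≡ i × Walk G v x d) × (∀ x j → c x ≡ i → Walk G v x j → d ≤ j)

SameCode : {V : Set} → Graph V → {k : ℕ} → (V → Fin k) → V → V → Set
SameCode G c u v = ∀ i d → (DistClass G c u i d → DistClass G c v i d)
                          × (DistClass G c v i d → DistClass G c u i d)

IsLocatingColoring : {V : Set} → Graph V → (k : ℕ) → (V → Fin k) → Set
IsLocatingColoring G k c = IsColoring G k c × (∀ u v → SameCode G c u v → u ≡ v)

HasLocatingColoring : {V : Set} → Graph V → ℕ → Set
HasLocatingColoring {V} G k = Σ (V → Fin k) λ c → IsLocatingColoring G k c

IsLocChromatic : {V : Set} → Graph V → ℕ → Set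
IsLocChromatic G k = HasLocatingColoring G k × (∀ j → HasLocatingColoring G j → k ≤ j)

module Submission where

open import Defs hiding (sym)
open import Data.Nat using (ℕ; zero; suc; _+_; _≤_; z≤n; s≤s)
open import Data.Nat.Properties using (≤-antisym; ≤-trans; ≤-pred; m≤n⇒m≤1+n; +-comm)
open import Data.Fin using (Fin; zero; suc; _↑ˡ_; _↑ʳ_; splitAt; join)
import Data.Fin as F
open import Data.Fin.Properties
  using (↑ˡ-injective; ↑ʳ-injective; splitAt-↑ˡ; splitAt-↑ʳ; join-splitAt; injective⇒≤)
open import Data.Product using (∃; _×_; _,_; proj₁; proj₂)
open import Data.Sum using (_⊎_; inj₁; inj₂)
open import Data.Bool using (true)
open import Data.Empty using (⊥-elim)
open import Function using (id)
open import Function.Bundles using (_⇔_; mk⇔; Equivalence)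
open import Function.Properties.Equivalence using () renaming (trans to ⇔-trans)
open import Relation.Nullary using (yes; no)
open import Relation.Nullary.Decidable using (isYes≗does; dec-true)
open import Relation.Binary.PropositionalEquality

-- Lower bound: a hub a together with its m pendant vertices must receive m + 1 distinct
-- colors, since two pendants at the same hub with the same color have the same code.
-- Upper bound: keep a locating coloring of G on the hubs and give the w-th pendant of
-- every hub the new color k + w.  A pendant then sees every old class at exactly one
-- more than its hub does, so the codes of hubs, and of pendants of equal color, are
-- told apart by the locating coloring of G.

module _ {V : Set} (G : Graph V) where

  sameCode⇒sameColor : ∀ {k} (c : V → Fin k) u v → SameCode G c u v → c v ≡ c u
  sameCode⇒sameColor c u v S
    with (x , cx≡cu , W) , _ ← proj₁ (S (c u) 0) ((u , refl , here) , λ _ _ _ _ → z≤n)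
    with here ← W
    = cx≡cu

  PendantAt : V → V → Set
  PendantAt p a = adj G p a ≡ true × (∀ u → adj G p u ≡ true → u ≡ a)

  pendant-walk : ∀ {p a x j} → PendantAt p a → Walk G p x (suc j) → Walk G a x j
  pendant-walk {x = x} {j} (_ , only) (step {w = u} e W) = subst (λ z → Walk G z x j) (only u e) W

  module _ {k : ℕ} (c : V → Fin k) where

    pendant-distClass : ∀ {p a i d} → PendantAt p a → c p ≢ i →
      DistClass G c p i (suc d) ⇔ DistClass G c a i d
    pendant-distClass {p} {a} {i} {d} pa@(p~a , _) cp≢i = mk⇔ to from
      where
      to : DistClass G c p i (suc d) → DistClass G c a i d
      to ((x , cx , W) , minimal) =
        (x , cx , pendant-walk pa W) , λ y j cy W′ → ≤-pred (minimal y (suc j) cy (step p~a W′))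

      from : DistClass G c a i d → DistClass G c p i (suc d)
      from ((x , cx , W) , minimal) = (x , cx , step p~a W) , nearest
        where
        nearest : ∀ y j → c y ≡ i → Walk G p y j → suc d ≤ j
        nearest y zero cy here = ⊥-elim (cp≢i cy)
        nearest y (suc j) cy W′ = s≤s (minimal y j cy (pendant-walk pa W′))

    -- Any walk leaving a pendant passes through its hub, which the twin reaches equally fast.
    twin-walk : ∀ {p q a z d} → PendantAt p a → PendantAt q a → c p ≡ c q →
      Walk G p z d → ∃ λ z′ → c z′ ≡ c z × Walk G q z′ d
    twin-walk {q = q} _ _ cp≡cq here = q , sym cp≡cq , here
    twin-walk pa (q~a , _) _ W@(step _ _) = _ , refl , step q~a (pendant-walk pa W)

    twin-distClass : ∀ {p q a i d} → PendantAt p a → PendantAt q a → c p ≡ c q →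
      DistClass G c p i d → DistClass G c q i d
    twin-distClass pa qa cp≡cq ((x , cx , W) , minimal)
      with x′ , cx′ , W′ ← twin-walk pa qa cp≡cq W
      = (x′ , trans cx′ cx , W′) , nearest
      where
      nearest : ∀ y j → c y ≡ _ → Walk G _ y j → _ ≤ j
      nearest y j cy U
        with y′ , cy′ , U′ ← twin-walk qa pa (sym cp≡cq) U
        = minimal y′ j (trans cy′ cy) U′

    twins-sameCode : ∀ {p q a} → PendantAt p a → PendantAt q a → c p ≡ c q → SameCode G c p q
    twins-sameCode pa qa cp≡cq i d =
      twin-distClass pa qa cp≡cq , twin-distClass qa pa (sym cp≡cq)

module Corona {n : ℕ} (G : Graph (Fin n)) (m : ℕ) where

  C : Graph (CVert n (Fin m))
  C = corona G (Empty m)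

  hub : CVert n (Fin m) → Fin n
  hub (inj₁ a) = a
  hub (inj₂ (a , _)) = a

  pendant : ∀ a w → PendantAt C (inj₂ (a , w)) (inj₁ a)
  pendant a w = trans (isYes≗does (a F.≟ a)) (dec-true (a F.≟ a) refl) , only
    where
    only : ∀ u → adj C (inj₂ (a , w)) u ≡ true → u ≡ inj₁ a
    only (inj₁ b) e with a F.≟ b
    ... | yes refl = refl
    only (inj₂ (b , _)) e with a F.≟ b
    only (inj₂ (b , _)) () | yes _
    only (inj₂ (b , _)) () | no _

  step-hub : ∀ u v → adj C u v ≡ true → hub u ≡ hub v ⊎ adj G (hub u) (hub v) ≡ true
  step-hub (inj₁ a) (inj₁ b) e = inj₂ e
  step-hub (inj₁ a) (inj₂ (b , _)) e with a F.≟ b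
  ... | yes a≡b = inj₁ a≡b
  step-hub (inj₁ a) (inj₂ (b , _)) () | no _
  step-hub (inj₂ (a , w)) v e = inj₁ (cong hub (sym (proj₂ (pendant a w) v e)))

  project-walk : ∀ {u v k} → Walk C u v k → ∃ λ k′ → k′ ≤ k × Walk G (hub u) (hub v) k′
  project-walk here = 0 , z≤n , here
  project-walk (step {u} {w} e W) with k′ , k′≤k , W′ ← project-walk W | step-hub u w e
  ... | inj₁ same = k′ , m≤n⇒m≤1+n k′≤k , subst (λ z → Walk G z _ k′) (sym same) W′
  ... | inj₂ e′ = suc k′ , s≤s k′≤k , step e′ W′

  lift-walk : ∀ {a b k} → Walk G a b k → Walk C (inj₁ a) (inj₁ b) k
  lift-walk here = here
  lift-walk (step e W) = step e (lift-walk W)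

  hasLocatingColoring⇒m< : ∀ {K} → Fin n → HasLocatingColoring C K → suc m ≤ K
  hasLocatingColoring⇒m< {K} a (c , (proper , _) , locating) = injective⇒≤ {f = color} injective
    where
    color : Fin (suc m) → Fin K
    color zero = c (inj₁ a)
    color (suc w) = c (inj₂ (a , w))

    injective : ∀ {x y} → color x ≡ color y → x ≡ y
    injective {zero} {zero} _ = refl
    injective {zero} {suc w} eq = ⊥-elim (proper (inj₁ a) (inj₂ (a , w)) (proj₁ (pendant a w)) eq)
    injective {suc w} {zero} eq = ⊥-elim (proper (inj₁ a) (inj₂ (a , w)) (proj₁ (pendant a w)) (sym eq))
    injective {suc w} {suc w′} eq
      with refl ← locating _ _ (twins-sameCode C c (pendant a w) (pendant a w′) eq) = refl

  module Extension {k : ℕ} (c : Fin n → Fin k) where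

    extend : CVert n (Fin m) → Fin (k + m)
    extend (inj₁ a) = c a ↑ˡ m
    extend (inj₂ (_ , w)) = k ↑ʳ w

    ↑ˡ≢↑ʳ : ∀ (i : Fin k) (w : Fin m) → i ↑ˡ m ≢ k ↑ʳ w
    ↑ˡ≢↑ʳ i w eq with () ← trans (sym (splitAt-↑ˡ k i m)) (trans (cong (splitAt k) eq) (splitAt-↑ʳ k m w))

    hub-distClass : ∀ {a i d} → DistClass C extend (inj₁ a) (i ↑ˡ m) d ⇔ DistClass G c a i d
    hub-distClass {a} {i} {d} = mk⇔ to from
      where
      to : DistClass C extend (inj₁ a) (i ↑ˡ m) d → DistClass G c a i d
      to ((inj₂ (_ , w) , cx , _) , _) = ⊥-elim (↑ˡ≢↑ʳ i w (sym cx))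
      to ((inj₁ b , cx , W) , minimal)
        with d′ , d′≤d , W′ ← project-walk W
        = (b , ↑ˡ-injective m _ _ cx , subst (Walk G a b) d′≡d W′)
        , λ y j cy U → minimal (inj₁ y) j (cong (_↑ˡ m) cy) (lift-walk U)
        where
        d′≡d = ≤-antisym d′≤d (minimal (inj₁ b) d′ cx (lift-walk W′))

      from : DistClass G c a i d → DistClass C extend (inj₁ a) (i ↑ˡ m) d
      from ((b , cb , W) , minimal) = (inj₁ b , cong (_↑ˡ m) cb , lift-walk W) , nearest
        where
        nearest : ∀ y j → extend y ≡ i ↑ˡ m → Walk C (inj₁ a) y j → d ≤ j
        nearest (inj₂ (_ , w)) j cy U = ⊥-elim (↑ˡ≢↑ʳ i w (sym cy))
        nearest (inj₁ b′) j cy U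
          with j′ , j′≤j , U′ ← project-walk U
          = ≤-trans (minimal b′ j′ (↑ˡ-injective m _ _ cy) U′) j′≤j

    pendant-distClass-extend : ∀ {a w i d} →
      DistClass C extend (inj₂ (a , w)) (i ↑ˡ m) (suc d) ⇔ DistClass G c a i d
    pendant-distClass-extend {a} {w} {i} =
      ⇔-trans (pendant-distClass C extend (pendant a w) (λ eq → ↑ˡ≢↑ʳ i w (sym eq))) hub-distClass

    -- The shift s is id for hubs and suc for pendants.
    sameCode-descends : ∀ {u v a b} (s : ℕ → ℕ) →
      (∀ {i d} → DistClass C extend u (i ↑ˡ m) (s d) ⇔ DistClass G c a i d) →
      (∀ {i d} → DistClass C extend v (i ↑ˡ m) (s d) ⇔ DistClass G c b i d) →
      SameCode C extend u v → SameCode G c a b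
    sameCode-descends s u≃a v≃b S i d =
      (λ D → to v≃b (proj₁ (S (i ↑ˡ m) (s d)) (from u≃a D))) ,
      (λ D → to u≃a (proj₂ (S (i ↑ˡ m) (s d)) (from v≃b D)))
      where open Equivalence

    extend-locating : Fin n → IsLocatingColoring G k c → IsLocatingColoring C (k + m) extend
    extend-locating a₀ ((proper , surjective) , locating) = (proper′ , surjective′) , locating′
      where
      proper′ : ∀ u v → adj C u v ≡ true → extend u ≢ extend v
      proper′ (inj₁ a) (inj₁ b) e eq = proper a b e (↑ˡ-injective m _ _ eq)
      proper′ (inj₁ a) (inj₂ (_ , w)) e eq = ↑ˡ≢↑ʳ _ w eq
      proper′ (inj₂ (_ , w)) (inj₁ b) e eq = ↑ˡ≢↑ʳ _ w (sym eq)
      proper′ (inj₂ (a , w)) (inj₂ v) e with () ← proj₂ (pendant a w) (inj₂ v) e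

      hit : ∀ y (s : Fin k ⊎ Fin m) → join k m s ≡ y → ∃ λ x → ∀ {z} → z ≡ x → extend z ≡ y
      hit y (inj₁ i) eq with a , ca≡i ← surjective i = inj₁ a , λ { refl → trans (cong (_↑ˡ m) (ca≡i refl)) eq }
      hit y (inj₂ w) eq = inj₂ (a₀ , w) , λ { refl → eq }

      surjective′ : ∀ y → ∃ λ x → ∀ {z} → z ≡ x → extend z ≡ y
      surjective′ y = hit y (splitAt k y) (join-splitAt k m y)

      locating′ : ∀ u v → SameCode C extend u v → u ≡ v
      locating′ (inj₁ a) (inj₁ b) S = cong inj₁ (locating a b (sameCode-descends id hub-distClass hub-distClass S))
      locating′ (inj₁ a) (inj₂ (_ , w)) S = ⊥-elim (↑ˡ≢↑ʳ _ w (sym (sameCode⇒sameColor C extend _ _ S)))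
      locating′ (inj₂ (_ , w)) (inj₁ b) S = ⊥-elim (↑ˡ≢↑ʳ _ w (sameCode⇒sameColor C extend _ _ S))
      locating′ (inj₂ (a , w)) (inj₂ (b , w′)) S
        with refl ← ↑ʳ-injective k _ _ (sameCode⇒sameColor C extend _ _ S)
        with refl ← locating a b (sameCode-descends suc pendant-distClass-extend pendant-distClass-extend S)
        = refl

theorem5 : (m n : ℕ) → 1 ≤ m → 2 ≤ n → (T : Graph (Fin n)) → IsTree T →
    (χT χC : ℕ) → IsLocChromatic T χT → IsLocChromatic (corona T (Empty m)) χC →
    (m + 1 ≤ χC) × (χC ≤ χT + m)
theorem5 m zero _ () _ _ _ _ _ _
theorem5 m (suc n) _ _ T _ χT χC ((c , c-locating) , _) (corona-coloring , χC-minimal) =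
  subst (_≤ χC) (+-comm 1 m) (hasLocatingColoring⇒m< zero corona-coloring) ,
  χC-minimal (χT + m) (extend , extend-locating zero c-locating)
  where
  open Corona T m
  open Extension c
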